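{- Let $\alpha=(\alpha_1,\dots,\alpha_n)$ be a composition of length $n$ and let $\ell\le k$ be positive integers. Then the map $\phi^{\operatorname{inv}}_{\alpha,k,\ell}: \mathcal{OP}_{\alpha^-,\ell}\times \binom{[0,\ell-1]}{\alpha_n-k+\ell}\times \left(\!\binom{[0,\ell]}{k-\ell}\!\right)\to \mathcal{OP}_{\alpha,k}$ is well-defined and injective, its image is the set of $\rho\in\mathcal{OP}_{\alpha,k}$ having exactly $k-\ell$ blocks equal to the singleton $\{n\}$, and for every $\pi\in\mathcal{OP}_{\alpha^-,\ell}$, $U\in\binom{[0,\ell-1]}{\alpha_n-k+\ell}$, $B\in\left(\!\binom{[0,\ell]}{k-\ell}\!\right)$, $$\operatorname{inv}\big(\phi^{\operatorname{inv}}_{\alpha,k,\ell}(\pi,U,B)\big)=\operatorname{inv}(\pi)+\sum_{u\in U}u+\sum_{b\in B}b .$$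
   Context: A composition is a finite sequence of positive integers; $|\alpha|=\sum\alpha_i$; $\alpha^-=(\alpha_1,\dots,\alpha_{n-1})$. $A(\alpha)$ is the multiset $\{i^{\alpha_i}\}$; $\mathcal{OP}_{\alpha,k}$ is the set of ordered multiset partitions of $A(\alpha)$ into $k$ blocks, i.e. sequences of $k$ nonempty sets whose multiset union is $A(\alpha)$. $[a,b]$ is the integer interval; $\binom{S}{m}$ is the set of $m$-element subsets of $S$, and $\left(\!\binom{S}{m}\!\right)$ is the set of $m$-element multisets with elements from $S$. $\operatorname{inv}(\pi)$ is the number of pairs of entries $(a,b)$ with $a>b$, $a$'s block strictly left of $b$'s block, and $b$ minimal in its block. Definition of $\phi^{\operatorname{inv}}_{\alpha,k,\ell}(\pi,U,B)$: label the blocks of $\pi$ from right to left by $0,1,\dots,\ell-1$ (these labels stay attached to the original blocks). Repeatedly remove a largest element $i$ from the multiset union $U\uplus B$, taking it from $U$ if the largest values in $U$ and $B$ are equal. If $i$ came from $U$, add $n$ to the block labeled $i$. If $i$ came from $B$ and $i=\ell$, add a new block $\{n\}$ at the left end (to the left of the block labeled $\ell-1$). If $i$ came from $B$ and $i<\ell$, add a new block $\{n\}$ immediately to the right of the block labeled $i$. When $U\uplus B$ is exhausted the result is $\phi^{\operatorname{inv}}_{\alpha,k,\ell}(\pi,U,B)$. -}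

module Defs where

open import Data.Nat using (ℕ; zero; suc; _+_; _∸_; _≤_; _<_; _>_; _≥_; _≟_; _<?_; _≤?_)
open import Data.List using (List; []; _∷_; _∷ʳ_; length; map; filter; concatMap)
open import Data.Nat.ListAction using (sum)
open import Data.List.Properties using (≡-dec)
open import Data.List.Relation.Unary.All using (All; all?)
open import Data.List.Relation.Unary.Linked using (Linked)
open import Data.Maybe using (Maybe; just; nothing)
open import Data.Product using (_×_; _,_; proj₂)
open import Relation.Binary.PropositionalEquality using (_≡_; _≢_)
open import Relation.Nullary using (does)
open import Data.Bool using (if_then_else_)

-- Convention: a block (a finite set of positive integers) is represented
-- canonically as a strictly increasing nonempty list.
IsBlock : List ℕ → Set
IsBlock P = (P ≢ []) × Linked _<_ P

-- multiplicity of x in A(α) = {i^{α_i}} (entries i ∈ [1,n], α = (α_1,…,α_n))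
mult : List ℕ → ℕ → ℕ
mult α zero = 0
mult [] (suc i) = 0
mult (a ∷ α) (suc zero) = a
mult (a ∷ α) (suc (suc i)) = mult α (suc i)

occ : ℕ → List ℕ → ℕ
occ x P = length (filter (x ≟_) P)

occAll : ℕ → List (List ℕ) → ℕ
occAll x π = sum (map (occ x) π)

OP : List ℕ → ℕ → List (List ℕ) → Set
OP α k π = (length π ≡ k) × All IsBlock π × (∀ x → occAll x π ≡ mult α x)

IsComposition : List ℕ → Set
IsComposition α = All (λ x → 1 ≤ x) α

-- U a subset of [0,ℓ-1], represented as a strictly decreasing list
-- (its size is constrained separately in the statement)
IsSubsetBelow : ℕ → List ℕ → Set
IsSubsetBelow ℓ U = Linked _>_ U × All (λ u → u < ℓ) U

-- B ∈ multichoose([0,ℓ], m): a multiset, represented as a weakly decreasing list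
IsMultisetOf : ℕ → ℕ → List ℕ → Set
IsMultisetOf ℓ m B = Linked _≥_ B × All (λ b → b ≤ ℓ) B × (length B ≡ m)

isMin : ℕ → List ℕ → Set
isMin b Q = All (λ c → b ≤ c) Q

pairsCount : List ℕ → List ℕ → ℕ
pairsCount P Q =
  length (filter (λ b → all? (b ≤?_) Q)
           (concatMap (λ a → filter (λ b → b <? a) Q) P))

inv : List (List ℕ) → ℕ
inv [] = 0
inv (P ∷ π) = sum (map (pairsCount P) π) + inv π

-- blocks carrying their original label (just i) or a new block (nothing)
LBlocks : Set
LBlocks = List (Maybe ℕ × List ℕ)

labelRL : List (List ℕ) → LBlocks
labelRL [] = []
labelRL (P ∷ π) = (just (length π) , P) ∷ labelRL π

isLabel : ℕ → Maybe ℕ → Set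
isLabel i (just j) = i ≡ j
isLabel i nothing = i ≡ suc i  -- never holds

isLabel? : (i : ℕ) (m : Maybe ℕ) → Relation.Nullary.Dec (isLabel i m)
isLabel? i (just j) = i ≟ j
isLabel? i nothing = i ≟ suc i

-- add n to the block labeled i (n exceeds all entries, so append keeps order)
addTo : ℕ → ℕ → LBlocks → LBlocks
addTo n i [] = []
addTo n i ((m , P) ∷ bs) =
  if does (isLabel? i m) then (m , P ∷ʳ n) ∷ addTo n i bs
  else (m , P) ∷ addTo n i bs

insertRightOf : ℕ → ℕ → LBlocks → LBlocks
insertRightOf n i [] = []
insertRightOf n i ((m , P) ∷ bs) =
  if does (isLabel? i m) then (m , P) ∷ (nothing , n ∷ []) ∷ bs
  else (m , P) ∷ insertRightOf n i bs

data Src : Set where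
  fromU : ℕ → Src
  fromB : ℕ → Src

removalOrder : List ℕ → List ℕ → List Src
removalOrder [] bs = map fromB bs
removalOrder (u ∷ us) [] = fromU u ∷ removalOrder us []
removalOrder (u ∷ us) (b ∷ bs) =
  if does (b ≤? u) then fromU u ∷ removalOrder us (b ∷ bs)
  else fromB b ∷ removalOrder (u ∷ us) bs

step : ℕ → ℕ → Src → LBlocks → LBlocks
step n ℓ (fromU i) bs = addTo n i bs
step n ℓ (fromB i) bs =
  if does (i ≟ ℓ) then (nothing , n ∷ []) ∷ bs
  else insertRightOf n i bs

run : ℕ → ℕ → List Src → LBlocks → LBlocks
run n ℓ [] bs = bs
run n ℓ (s ∷ ss) bs = run n ℓ ss (step n ℓ s bs)

-- φ^inv_{α,k,ℓ}(π,U,B), where n = length α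
phiInv : (n ℓ : ℕ) → List (List ℕ) → List ℕ → List ℕ → List (List ℕ)
phiInv n ℓ π U B = map proj₂ (run n ℓ (removalOrder U B) (labelRL π))

singletons : ℕ → List (List ℕ) → ℕ
singletons n ρ = length (filter (λ P → ≡-dec _≟_ P (n ∷ [])) ρ)

-- φ has a closed form: writing cu j and cb j for the multiplicities of j in U and B,
-- φ(π, U, B) appends cu j copies of n to the block of π labelled j, puts cb j singletons {n}
-- immediately to its right and cb ℓ singletons {n} in front; the order in which U ⊎ B is
-- consumed does not matter. As n exceeds every entry of π, each of these copies of n forms an
-- inversion exactly with the minima of the j old blocks to its right, which gives
-- inv π + ΣU + ΣB. Conversely, ρ is decoded from the right: the singletons {n} are the new
-- blocks and every other block gives back its trailing n, if any, to U; this recovers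
-- (π, U, B) uniquely, and the number of singletons {n} is |B| = k − ℓ.

module Submission where

open import Defs
open import Data.Nat using (ℕ; zero; suc; _+_; _*_; _∸_; _≤_; _<_; _>_; _≥_; _≟_; _≤ᵇ_; s≤s; z≤n)
open import Data.Nat.Properties
open import Data.Nat.ListAction using (sum)
open import Data.Nat.ListAction.Properties using (sum-++)
open import Data.Nat.Tactic.RingSolver using (solve-∀)
open import Data.List using (List; []; _∷_; _∷ʳ_; _++_; [_]; length; map; filter; replicate; concatMap)
open import Data.List.Properties
  using (filter-accept; filter-reject; filter-++; filter-all; filter-none; length-++; length-replicate;
         map-++; map-replicate; map-id; ++-assoc; ++-identityʳ; ∷-injective; ≡-dec)
open import Data.List.Relation.Unary.All as All using (All; []; _∷_; all?)
open import Data.List.Relation.Unary.All.Properties using (++⁺; ++⁻ˡ; replicate⁺; all-filter)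
open import Data.List.Relation.Unary.Linked as Linked using (Linked; []; [-]; _∷_)
open import Data.List.Relation.Unary.Linked.Properties using (Linked⇒All)
open import Data.Maybe using (just; nothing)
open import Data.Product using (_×_; _,_; proj₁; proj₂; map₁; Σ-syntax)
open import Data.Sum using (inj₁; inj₂)
open import Data.Bool using (true; false)
open import Data.Empty using (⊥-elim)
open import Function using (flip; _⇔_; mk⇔; Equivalence)
open import Relation.Binary using (Transitive; tri<; tri≈; tri>)
open import Relation.Unary using (Decidable)
open import Relation.Binary.PropositionalEquality hiding ([_])
open import Relation.Nullary using (yes; no; does)
open import Relation.Nullary.Decidable using (dec-true; dec-false)

occ-∷ : ∀ x i l → occ x (i ∷ l) ≡ occ x [ i ] + occ x l
occ-∷ x i l with x ≟ i
... | yes p rewrite filter-accept (x ≟_) {i} {l} p | filter-accept (x ≟_) {i} {[]} p = refl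
... | no p rewrite filter-reject (x ≟_) {i} {l} p | filter-reject (x ≟_) {i} {[]} p = refl

occ-self : ∀ x → occ x [ x ] ≡ 1
occ-self x rewrite filter-accept (x ≟_) {x} {[]} refl = refl

occ-other : ∀ {x i} → x ≢ i → occ x [ i ] ≡ 0
occ-other {x} {i} x≢i rewrite filter-reject (x ≟_) {i} {[]} x≢i = refl

occ-∷-≡ : ∀ x l → occ x (x ∷ l) ≡ suc (occ x l)
occ-∷-≡ x l = trans (occ-∷ x x l) (cong (_+ occ x l) (occ-self x))

occ-∷-≢ : ∀ {x i} l → x ≢ i → occ x (i ∷ l) ≡ occ x l
occ-∷-≢ {x} {i} l x≢i = trans (occ-∷ x i l) (cong (_+ occ x l) (occ-other x≢i))

occ-++ : ∀ x P Q → occ x (P ++ Q) ≡ occ x P + occ x Q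
occ-++ x P Q = trans (cong length (filter-++ (x ≟_) P Q)) (length-++ (filter (x ≟_) P))

occ-replicate : ∀ x c n → occ x (replicate c n) ≡ c * occ x [ n ]
occ-replicate x zero n = refl
occ-replicate x (suc c) n = trans (occ-∷ x n (replicate c n)) (cong (occ x [ n ] +_) (occ-replicate x c n))

occ-none : ∀ {x} l → All (x ≢_) l → occ x l ≡ 0
occ-none {x} l h = cong length (filter-none (x ≟_) h)

occ-above : ∀ {x y} l → All (_≤ y) l → y < x → occ x l ≡ 0
occ-above l h y<x = occ-none l (All.map (λ z≤y x≡z → <-irrefl (sym x≡z) (≤-<-trans z≤y y<x)) h)

occ-below : ∀ {x y} l → All (_< y) l → y ≤ x → occ x l ≡ 0
occ-below l h y≤x = occ-none l (All.map (λ z<y x≡z → <-irrefl (sym x≡z) (<-≤-trans z<y y≤x)) h)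

All<-of-occ : ∀ m P → (∀ y → m ≤ y → occ y P ≡ 0) → All (_< m) P
All<-of-occ m [] h = []
All<-of-occ m (p ∷ P) h with m ≤? p
... | yes m≤p with () ← trans (sym (occ-∷-≡ p P)) (h p m≤p)
... | no m≰p = ≰⇒> m≰p ∷ All<-of-occ m P (λ y m≤y → m+n≡0⇒n≡0 (occ y [ p ]) (trans (sym (occ-∷ y p P)) (h y m≤y)))

All<-of-occAll : ∀ m π → (∀ y → m ≤ y → occAll y π ≡ 0) → All (All (_< m)) π
All<-of-occAll m [] h = []
All<-of-occAll m (P ∷ π) h =
  All<-of-occ m P (λ y m≤y → m+n≡0⇒m≡0 (occ y P) (h y m≤y))
  ∷ All<-of-occAll m π (λ y m≤y → m+n≡0⇒n≡0 (occ y P) (h y m≤y))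

head-All : ∀ {R : ℕ → ℕ → Set} → Transitive R → ∀ {x xs} → Linked R (x ∷ xs) → All (R x) xs
head-All t [-] = []
head-All t (r ∷ rs) = Linked⇒All t r rs

Linked-∷ : ∀ {R : ℕ → ℕ → Set} {x} ys → All (R x) ys → Linked R ys → Linked R (x ∷ ys)
Linked-∷ [] _ _ = [-]
Linked-∷ (y ∷ ys) (r ∷ _) rs = r ∷ rs

Linked<-∷ʳ : ∀ {n} P → Linked _<_ P → All (_< n) P → Linked _<_ (P ∷ʳ n)
Linked<-∷ʳ [] _ _ = [-]
Linked<-∷ʳ (p ∷ P) lk (p<n ∷ h) = Linked-∷ (P ∷ʳ _) (++⁺ (head-All <-trans lk) (p<n ∷ [])) (Linked<-∷ʳ P (Linked.tail lk) h)

occ≤1 : ∀ x U → Linked _>_ U → occ x U ≤ 1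
occ≤1 x [] _ = z≤n
occ≤1 x (u ∷ U) lk with x ≟ u
... | yes refl = ≤-reflexive (trans (occ-∷-≡ x U) (cong suc (occ-below U (head-All (flip <-trans) lk) ≤-refl)))
... | no x≢u = subst (_≤ 1) (sym (occ-∷-≢ U x≢u)) (occ≤1 x U (Linked.tail lk))

≥-sorted-occ-unique : ∀ xs ys → Linked _≥_ xs → Linked _≥_ ys → (∀ j → occ j xs ≡ occ j ys) → xs ≡ ys
≥-sorted-occ-unique [] [] _ _ h = refl
≥-sorted-occ-unique [] (y ∷ ys) _ _ h with () ← trans (h y) (occ-∷-≡ y ys)
≥-sorted-occ-unique (x ∷ xs) [] _ _ h with () ← trans (sym (h x)) (occ-∷-≡ x xs)
≥-sorted-occ-unique (x ∷ xs) (y ∷ ys) lx ly h =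
  cong₂ _∷_ x≡y (≥-sorted-occ-unique xs ys (Linked.tail lx) (Linked.tail ly) tails)
  where
  head≤head : ∀ a as b bs → Linked _≥_ (b ∷ bs) → (∀ j → occ j (a ∷ as) ≡ occ j (b ∷ bs)) → a ≤ b
  head≤head a as b bs lb h′ with a ≤? b
  ... | yes a≤b = a≤b
  ... | no a≰b with () ← trans (sym (occ-∷-≡ a as))
                          (trans (h′ a) (occ-above (b ∷ bs) (≤-refl ∷ head-All (flip ≤-trans) lb) (≰⇒> a≰b)))
  x≡y : x ≡ y
  x≡y = ≤-antisym (head≤head x xs y ys ly h) (head≤head y ys x xs lx (λ j → sym (h j)))
  tails : ∀ j → occ j xs ≡ occ j ys
  tails j = +-cancelˡ-≡ (occ j [ x ]) _ _
    (trans (sym (occ-∷ j x xs)) (trans (h j) (trans (occ-∷ j y ys) (cong (λ z → occ j [ z ] + occ j ys) (sym x≡y)))))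

sumBelow : (ℕ → ℕ) → ℕ → ℕ
sumBelow f zero = 0
sumBelow f (suc m) = f m + sumBelow f m

sumBelow-cong : ∀ (f g : ℕ → ℕ) m → (∀ j → j < m → f j ≡ g j) → sumBelow f m ≡ sumBelow g m
sumBelow-cong f g zero h = refl
sumBelow-cong f g (suc m) h = cong₂ _+_ (h m ≤-refl) (sumBelow-cong f g m (λ j j<m → h j (m<n⇒m<1+n j<m)))

sumBelow-zero : ∀ (f : ℕ → ℕ) m → (∀ j → j < m → f j ≡ 0) → sumBelow f m ≡ 0
sumBelow-zero f m h = trans (sumBelow-cong f (λ _ → 0) m h) (zeros m)
  where zeros : ∀ m → sumBelow (λ _ → 0) m ≡ 0
        zeros zero = refl
        zeros (suc m) = zeros m

sumBelow-+ : ∀ (f g : ℕ → ℕ) m → sumBelow (λ j → f j + g j) m ≡ sumBelow f m + sumBelow g m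
sumBelow-+ f g zero = refl
sumBelow-+ f g (suc m) rewrite sumBelow-+ f g m = lemma (f m) (g m) (sumBelow f m) (sumBelow g m)
  where lemma : ∀ a b c d → a + b + (c + d) ≡ a + c + (b + d)
        lemma = solve-∀

sumBelow-indicator : ∀ (g : ℕ → ℕ) {x} m → x < m → sumBelow (λ j → g j * occ j [ x ]) m ≡ g x
sumBelow-indicator g {x} (suc m) x<1+m with m ≟ x
... | yes refl = trans (cong₂ _+_ (trans (cong (g m *_) (occ-self m)) (*-identityʳ (g m)))
                                  (sumBelow-zero _ m (λ j j<m → trans (cong (g j *_) (occ-other (<⇒≢ j<m))) (*-zeroʳ (g j)))))
                       (+-identityʳ (g m))
... | no m≢x = trans (cong (_+ sumBelow (λ j → g j * occ j [ x ]) m) (trans (cong (g m *_) (occ-other m≢x)) (*-zeroʳ (g m))))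
                     (sumBelow-indicator g m (≤∧≢⇒< (≤-pred x<1+m) (λ x≡m → m≢x (sym x≡m))))

sumBelow-occ : ∀ (g : ℕ → ℕ) m l → All (_< m) l → sumBelow (λ j → g j * occ j l) m ≡ sum (map g l)
sumBelow-occ g m [] [] = sumBelow-zero _ m (λ j _ → *-zeroʳ (g j))
sumBelow-occ g m (x ∷ l) (x<m ∷ h) =
  trans (sumBelow-cong _ (λ j → g j * occ j [ x ] + g j * occ j l) m
          (λ j _ → trans (cong (g j *_) (occ-∷ j x l)) (*-distribˡ-+ (g j) _ _)))
    (trans (sumBelow-+ _ _ m) (cong₂ _+_ (sumBelow-indicator g m x<m) (sumBelow-occ g m l h)))

sumBelow-occ-length : ∀ m l → All (_< m) l → sumBelow (λ j → occ j l) m ≡ length l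
sumBelow-occ-length m l h =
  trans (sumBelow-cong _ (λ j → 1 * occ j l) m (λ j _ → sym (*-identityˡ _)))
    (trans (sumBelow-occ (λ _ → 1) m l h) (ones l))
  where ones : ∀ (l : List ℕ) → sum (map (λ _ → 1) l) ≡ length l
        ones [] = refl
        ones (_ ∷ l) = cong suc (ones l)

sumBelow-occ-sum : ∀ m l → All (_< m) l → sumBelow (λ j → j * occ j l) m ≡ sum l
sumBelow-occ-sum m l h = trans (sumBelow-occ (λ j → j) m l h) (cong sum (map-id l))

-- The closed form of φ

occs : List ℕ → ℕ → ℕ
occs l x = occ x l

_⊕_ : (ℕ → ℕ) → List ℕ → ℕ → ℕ
(c ⊕ l) x = c x + occ x l

⊕-self : ∀ c i → (c ⊕ [ i ]) i ≡ suc (c i)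
⊕-self c i = trans (cong (c i +_) (occ-self i)) (+-comm (c i) 1)

⊕-other : ∀ c {i j} → j ≢ i → (c ⊕ [ i ]) j ≡ c j
⊕-other c {j = j} j≢i = trans (cong (c j +_) (occ-other j≢i)) (+-identityʳ (c j))

⊕-∷ : ∀ c i l j → ((c ⊕ [ i ]) ⊕ l) j ≡ (c ⊕ (i ∷ l)) j
⊕-∷ c i l j = trans (+-assoc (c j) _ _) (cong (c j +_) (sym (occ-∷ j i l)))

freshᴸ : ℕ → ℕ → LBlocks
freshᴸ n c = replicate c (nothing , [ n ])

bodyᴸ : ℕ → (ℕ → ℕ) → (ℕ → ℕ) → List (List ℕ) → LBlocks
bodyᴸ n cu cb [] = []
bodyᴸ n cu cb (P ∷ π) =
  (just (length π) , P ++ replicate (cu (length π)) n) ∷ freshᴸ n (cb (length π)) ++ bodyᴸ n cu cb π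

layoutᴸ : ℕ → ℕ → (ℕ → ℕ) → (ℕ → ℕ) → List (List ℕ) → LBlocks
layoutᴸ n ℓ cu cb π = freshᴸ n (cb ℓ) ++ bodyᴸ n cu cb π

body : ℕ → (ℕ → ℕ) → (ℕ → ℕ) → List (List ℕ) → List (List ℕ)
body n cu cb [] = []
body n cu cb (P ∷ π) =
  (P ++ replicate (cu (length π)) n) ∷ replicate (cb (length π)) [ n ] ++ body n cu cb π

layout : ℕ → ℕ → (ℕ → ℕ) → (ℕ → ℕ) → List (List ℕ) → List (List ℕ)
layout n ℓ cu cb π = replicate (cb ℓ) [ n ] ++ body n cu cb π

bodyᴸ-cong : ∀ n {cu cu′ cb cb′} π → (∀ j → j < length π → cu j ≡ cu′ j) → (∀ j → j < length π → cb j ≡ cb′ j) →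
  bodyᴸ n cu cb π ≡ bodyᴸ n cu′ cb′ π
bodyᴸ-cong n [] hu hb = refl
bodyᴸ-cong n (P ∷ π) hu hb
  rewrite hu (length π) ≤-refl | hb (length π) ≤-refl
        | bodyᴸ-cong n π (λ j j< → hu j (m<n⇒m<1+n j<)) (λ j j< → hb j (m<n⇒m<1+n j<)) = refl

layoutᴸ-cong : ∀ n ℓ {cu cu′ cb cb′} π → (∀ j → cu j ≡ cu′ j) → (∀ j → cb j ≡ cb′ j) →
  layoutᴸ n ℓ cu cb π ≡ layoutᴸ n ℓ cu′ cb′ π
layoutᴸ-cong n ℓ π hu hb = cong₂ _++_ (cong (freshᴸ n) (hb ℓ)) (bodyᴸ-cong n π (λ j _ → hu j) (λ j _ → hb j))

layoutᴸ-bump : ∀ n cu cb π →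
  layoutᴸ n (length π) cu (cb ⊕ [ length π ]) π ≡ (nothing , [ n ]) ∷ layoutᴸ n (length π) cu cb π
layoutᴸ-bump n cu cb π =
  cong₂ _++_ (cong (freshᴸ n) (⊕-self cb (length π)))
             (bodyᴸ-cong n π (λ _ _ → refl) (λ j j<m → ⊕-other cb (<⇒≢ j<m)))

isLabel-nothing : ∀ i → does (isLabel? i nothing) ≡ false
isLabel-nothing i = dec-false (i ≟ suc i) (λ i≡1+i → 1+n≢n (sym i≡1+i))

addTo-here : ∀ {n i} X r → addTo n i ((just i , X) ∷ r) ≡ (just i , X ∷ʳ n) ∷ addTo n i r
addTo-here {i = i} X r rewrite dec-true (i ≟ i) refl = refl

addTo-there : ∀ {n i m} X r → i ≢ m → addTo n i ((just m , X) ∷ r) ≡ (just m , X) ∷ addTo n i r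
addTo-there {i = i} {m} X r i≢m rewrite dec-false (i ≟ m) i≢m = refl

addTo-freshᴸ : ∀ n i c r → addTo n i (freshᴸ n c ++ r) ≡ freshᴸ n c ++ addTo n i r
addTo-freshᴸ n i zero r = refl
addTo-freshᴸ n i (suc c) r rewrite isLabel-nothing i = cong (_ ∷_) (addTo-freshᴸ n i c r)

++-replicate-∷ʳ : ∀ (P : List ℕ) c n → (P ++ replicate c n) ∷ʳ n ≡ P ++ replicate (suc c) n
++-replicate-∷ʳ P c n = trans (++-assoc P (replicate c n) [ n ]) (cong (P ++_) (replicate-∷ʳ c))
  where replicate-∷ʳ : ∀ c → replicate c n ∷ʳ n ≡ n ∷ replicate c n
        replicate-∷ʳ zero = refl
        replicate-∷ʳ (suc c) = cong (n ∷_) (replicate-∷ʳ c)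

addTo-layoutᴸ : ∀ n i ℓ cu cb π → addTo n i (layoutᴸ n ℓ cu cb π) ≡ layoutᴸ n ℓ (cu ⊕ [ i ]) cb π

addTo-bodyᴸ : ∀ n i cu cb π → addTo n i (bodyᴸ n cu cb π) ≡ bodyᴸ n (cu ⊕ [ i ]) cb π
addTo-bodyᴸ n i cu cb [] = refl
addTo-bodyᴸ n i cu cb (P ∷ π) with i ≟ length π
... | yes refl = trans (addTo-here _ (layoutᴸ n i cu cb π))
  (cong₂ (λ X r → (just i , X) ∷ r)
         (trans (++-replicate-∷ʳ P (cu i) n) (cong (λ c → P ++ replicate c n) (sym (⊕-self cu i))))
         (addTo-layoutᴸ n i i cu cb π))
... | no i≢m = trans (addTo-there _ (layoutᴸ n (length π) cu cb π) i≢m)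
  (cong₂ (λ X r → (just (length π) , X) ∷ r)
         (cong (λ c → P ++ replicate c n) (sym (⊕-other cu (λ m≡i → i≢m (sym m≡i)))))
         (addTo-layoutᴸ n i (length π) cu cb π))

addTo-layoutᴸ n i ℓ cu cb π = trans (addTo-freshᴸ n i (cb ℓ) _) (cong (freshᴸ n (cb ℓ) ++_) (addTo-bodyᴸ n i cu cb π))

insertRightOf-here : ∀ {n i} X r → insertRightOf n i ((just i , X) ∷ r) ≡ (just i , X) ∷ (nothing , [ n ]) ∷ r
insertRightOf-here {i = i} X r rewrite dec-true (i ≟ i) refl = refl

insertRightOf-there : ∀ {n i m} X r → i ≢ m → insertRightOf n i ((just m , X) ∷ r) ≡ (just m , X) ∷ insertRightOf n i r
insertRightOf-there {i = i} {m} X r i≢m rewrite dec-false (i ≟ m) i≢m = refl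

insertRightOf-freshᴸ : ∀ n i c r → insertRightOf n i (freshᴸ n c ++ r) ≡ freshᴸ n c ++ insertRightOf n i r
insertRightOf-freshᴸ n i zero r = refl
insertRightOf-freshᴸ n i (suc c) r rewrite isLabel-nothing i = cong (_ ∷_) (insertRightOf-freshᴸ n i c r)

insertRightOf-layoutᴸ : ∀ n i ℓ cu cb π → ℓ ≢ i →
  insertRightOf n i (layoutᴸ n ℓ cu cb π) ≡ layoutᴸ n ℓ cu (cb ⊕ [ i ]) π

insertRightOf-bodyᴸ : ∀ n i cu cb π → insertRightOf n i (bodyᴸ n cu cb π) ≡ bodyᴸ n cu (cb ⊕ [ i ]) π
insertRightOf-bodyᴸ n i cu cb [] = refl
insertRightOf-bodyᴸ n i cu cb (P ∷ π) with i ≟ length π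
... | yes refl = trans (insertRightOf-here _ (layoutᴸ n i cu cb π)) (cong (_ ∷_) (sym (layoutᴸ-bump n cu cb π)))
... | no i≢m = trans (insertRightOf-there _ (layoutᴸ n (length π) cu cb π) i≢m)
  (cong (_ ∷_) (insertRightOf-layoutᴸ n i (length π) cu cb π (λ m≡i → i≢m (sym m≡i))))

insertRightOf-layoutᴸ n i ℓ cu cb π ℓ≢i =
  trans (insertRightOf-freshᴸ n i (cb ℓ) _)
        (cong₂ _++_ (cong (freshᴸ n) (sym (⊕-other cb ℓ≢i))) (insertRightOf-bodyᴸ n i cu cb π))

step-fromB-new : ∀ n ℓ st → step n ℓ (fromB ℓ) st ≡ (nothing , [ n ]) ∷ st
step-fromB-new n ℓ st rewrite dec-true (ℓ ≟ ℓ) refl = refl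

step-fromB-insert : ∀ n ℓ i st → i ≢ ℓ → step n ℓ (fromB i) st ≡ insertRightOf n i st
step-fromB-insert n ℓ i st i≢ℓ rewrite dec-false (i ≟ ℓ) i≢ℓ = refl

step-fromB : ∀ n i cu cb π → let ℓ = length π in
  step n ℓ (fromB i) (layoutᴸ n ℓ cu cb π) ≡ layoutᴸ n ℓ cu (cb ⊕ [ i ]) π
step-fromB n i cu cb π with i ≟ length π
... | yes refl = trans (step-fromB-new n i _) (sym (layoutᴸ-bump n cu cb π))
... | no i≢ℓ = trans (step-fromB-insert n _ i _ i≢ℓ)
                     (insertRightOf-layoutᴸ n i (length π) cu cb π (λ ℓ≡i → i≢ℓ (sym ℓ≡i)))

takenFromU : List Src → List ℕ
takenFromU [] = []
takenFromU (fromU i ∷ ss) = i ∷ takenFromU ss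
takenFromU (fromB _ ∷ ss) = takenFromU ss

takenFromB : List Src → List ℕ
takenFromB [] = []
takenFromB (fromU _ ∷ ss) = takenFromB ss
takenFromB (fromB i ∷ ss) = i ∷ takenFromB ss

run-layoutᴸ : ∀ n π ss cu cb → let ℓ = length π in
  run n ℓ ss (layoutᴸ n ℓ cu cb π) ≡ layoutᴸ n ℓ (cu ⊕ takenFromU ss) (cb ⊕ takenFromB ss) π
run-layoutᴸ n π [] cu cb = layoutᴸ-cong n _ π (λ j → sym (+-identityʳ (cu j))) (λ j → sym (+-identityʳ (cb j)))
run-layoutᴸ n π (fromU i ∷ ss) cu cb rewrite addTo-layoutᴸ n i (length π) cu cb π =
  trans (run-layoutᴸ n π ss _ cb) (layoutᴸ-cong n _ π (⊕-∷ cu i (takenFromU ss)) (λ _ → refl))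
run-layoutᴸ n π (fromB i ∷ ss) cu cb rewrite step-fromB n i cu cb π =
  trans (run-layoutᴸ n π ss cu _) (layoutᴸ-cong n _ π (λ _ → refl) (⊕-∷ cb i (takenFromB ss)))

removalOrder-∷∷ : ∀ (P : List Src → Set) u U b B →
  P (fromU u ∷ removalOrder U (b ∷ B)) → P (fromB b ∷ removalOrder (u ∷ U) B) → P (removalOrder (u ∷ U) (b ∷ B))
removalOrder-∷∷ P u U b B pU pB with b ≤ᵇ u
... | true = pU
... | false = pB

takenFromU-removalOrder : ∀ U B → takenFromU (removalOrder U B) ≡ U
takenFromU-removalOrder [] [] = refl
takenFromU-removalOrder [] (b ∷ B) = takenFromU-removalOrder [] B
takenFromU-removalOrder (u ∷ U) [] = cong (u ∷_) (takenFromU-removalOrder U [])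
takenFromU-removalOrder (u ∷ U) (b ∷ B) =
  removalOrder-∷∷ (λ ss → takenFromU ss ≡ u ∷ U) u U b B
    (cong (u ∷_) (takenFromU-removalOrder U (b ∷ B))) (takenFromU-removalOrder (u ∷ U) B)

takenFromB-removalOrder : ∀ U B → takenFromB (removalOrder U B) ≡ B
takenFromB-removalOrder [] [] = refl
takenFromB-removalOrder [] (b ∷ B) = cong (b ∷_) (takenFromB-removalOrder [] B)
takenFromB-removalOrder (u ∷ U) [] = takenFromB-removalOrder U []
takenFromB-removalOrder (u ∷ U) (b ∷ B) =
  removalOrder-∷∷ (λ ss → takenFromB ss ≡ b ∷ B) u U b B
    (takenFromB-removalOrder U (b ∷ B)) (cong (b ∷_) (takenFromB-removalOrder (u ∷ U) B))

labelRL-bodyᴸ : ∀ n π → labelRL π ≡ bodyᴸ n (λ _ → 0) (λ _ → 0) π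
labelRL-bodyᴸ n [] = refl
labelRL-bodyᴸ n (P ∷ π) = cong₂ (λ Q r → (just (length π) , Q) ∷ r) (sym (++-identityʳ P)) (labelRL-bodyᴸ n π)

map-proj₂-bodyᴸ : ∀ n cu cb π → map proj₂ (bodyᴸ n cu cb π) ≡ body n cu cb π
map-proj₂-bodyᴸ n cu cb [] = refl
map-proj₂-bodyᴸ n cu cb (P ∷ π) = cong (_ ∷_) (map-proj₂-layoutᴸ (length π))
  where map-proj₂-layoutᴸ : ∀ ℓ → map proj₂ (layoutᴸ n ℓ cu cb π) ≡ layout n ℓ cu cb π
        map-proj₂-layoutᴸ ℓ = trans (map-++ proj₂ (freshᴸ n (cb ℓ)) _)
          (cong₂ _++_ (map-replicate proj₂ (cb ℓ) _) (map-proj₂-bodyᴸ n cu cb π))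

shape : ℕ → List (List ℕ) → List ℕ → List ℕ → List (List ℕ)
shape n π U B = layout n (length π) (occs U) (occs B) π

phiInv≡shape : ∀ n π U B → phiInv n (length π) π U B ≡ shape n π U B
phiInv≡shape n π U B = begin
  map proj₂ (run n ℓ (removalOrder U B) (labelRL π))
    ≡⟨ cong (λ r → map proj₂ (run n ℓ (removalOrder U B) r)) (labelRL-bodyᴸ n π) ⟩
  map proj₂ (run n ℓ (removalOrder U B) (layoutᴸ n ℓ (λ _ → 0) (λ _ → 0) π))
    ≡⟨ cong (map proj₂) (run-layoutᴸ n π (removalOrder U B) _ _) ⟩
  map proj₂ (layoutᴸ n ℓ (occs (takenFromU (removalOrder U B))) (occs (takenFromB (removalOrder U B))) π)
    ≡⟨ cong₂ (λ U′ B′ → map proj₂ (layoutᴸ n ℓ (occs U′) (occs B′) π)) (takenFromU-removalOrder U B) (takenFromB-removalOrder U B) ⟩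
  map proj₂ (layoutᴸ n ℓ (occs U) (occs B) π)
    ≡⟨ map-++ proj₂ (freshᴸ n (occ ℓ B)) _ ⟩
  map proj₂ (freshᴸ n (occ ℓ B)) ++ map proj₂ (bodyᴸ n (occs U) (occs B) π)
    ≡⟨ cong₂ _++_ (map-replicate proj₂ (occ ℓ B) _) (map-proj₂-bodyᴸ n _ _ π) ⟩
  layout n ℓ (occs U) (occs B) π ∎
  where open ≡-Reasoning
        ℓ = length π

-- Statistics of the closed form

BlocksBelow : ℕ → List (List ℕ) → Set
BlocksBelow n π = All (λ P → IsBlock P × All (_< n) P) π

length-body : ∀ n cu cb π → length (body n cu cb π) ≡ length π + sumBelow cb (length π)
length-body n cu cb [] = refl
length-body n cu cb (P ∷ π) = cong suc (trans (length-++ (replicate (cb m) [ n ]))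
    (trans (cong₂ _+_ (length-replicate (cb m)) (length-body n cu cb π)) (lemma (cb m) m (sumBelow cb m))))
  where m = length π
        lemma : ∀ a b c → a + (b + c) ≡ b + (a + c)
        lemma = solve-∀

sumBelow-occs-B : ∀ ℓ B → All (_≤ ℓ) B → occ ℓ B + sumBelow (occs B) ℓ ≡ length B
sumBelow-occs-B ℓ B h = sumBelow-occ-length (suc ℓ) B (All.map s≤s h)

length-shape : ∀ n π U B → All (_≤ length π) B → length (shape n π U B) ≡ length π + length B
length-shape n π U B hB = trans (length-++ (replicate (occ ℓ B) [ n ]))
    (trans (cong₂ _+_ (length-replicate (occ ℓ B)) (length-body n (occs U) (occs B) π))
      (trans (lemma (occ ℓ B) ℓ (sumBelow (occs B) ℓ)) (cong (ℓ +_) (sumBelow-occs-B ℓ B hB))))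
  where ℓ = length π
        lemma : ∀ a b c → a + (b + c) ≡ b + (a + c)
        lemma = solve-∀

singletons-∷-≡ : ∀ n ρ → singletons n ([ n ] ∷ ρ) ≡ suc (singletons n ρ)
singletons-∷-≡ n ρ = cong length (filter-accept (λ P → ≡-dec _≟_ P [ n ]) {[ n ]} {ρ} refl)

singletons-∷-≢ : ∀ n {X} ρ → X ≢ [ n ] → singletons n (X ∷ ρ) ≡ singletons n ρ
singletons-∷-≢ n {X} ρ X≢[n] = cong length (filter-reject (λ P → ≡-dec _≟_ P [ n ]) {X} {ρ} X≢[n])

singletons-replicate : ∀ n c ρ → singletons n (replicate c [ n ] ++ ρ) ≡ c + singletons n ρ
singletons-replicate n zero ρ = refl
singletons-replicate n (suc c) ρ = trans (singletons-∷-≡ n _) (cong suc (singletons-replicate n c ρ))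

extended-block≢[n] : ∀ {n} P c → IsBlock P → All (_< n) P → P ++ replicate c n ≢ [ n ]
extended-block≢[n] [] c (P≢[] , _) _ _ = P≢[] refl
extended-block≢[n] (p ∷ P) c _ (p<n ∷ _) eq = <-irrefl (proj₁ (∷-injective eq)) p<n

singletons-body : ∀ n cu cb π → BlocksBelow n π → singletons n (body n cu cb π) ≡ sumBelow cb (length π)
singletons-body n cu cb [] _ = refl
singletons-body n cu cb (P ∷ π) ((bP , P<n) ∷ g) =
  trans (singletons-∷-≢ n _ (extended-block≢[n] P (cu (length π)) bP P<n))
    (trans (singletons-replicate n (cb (length π)) _) (cong (cb (length π) +_) (singletons-body n cu cb π g)))

singletons-shape : ∀ n π U B → BlocksBelow n π → All (_≤ length π) B → singletons n (shape n π U B) ≡ length B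
singletons-shape n π U B g hB =
  trans (singletons-replicate n (occ ℓ B) _)
    (trans (cong (occ ℓ B +_) (singletons-body n (occs U) (occs B) π g)) (sumBelow-occs-B ℓ B hB))
  where ℓ = length π

occAll-++ : ∀ x ρ σ → occAll x (ρ ++ σ) ≡ occAll x ρ + occAll x σ
occAll-++ x ρ σ = trans (cong sum (map-++ (occ x) ρ σ)) (sum-++ (map (occ x) ρ) (map (occ x) σ))

occAll-replicate : ∀ x c n → occAll x (replicate c [ n ]) ≡ c * occ x [ n ]
occAll-replicate x zero n = refl
occAll-replicate x (suc c) n = cong (occ x [ n ] +_) (occAll-replicate x c n)

occAll-body : ∀ x n cu cb π →
  occAll x (body n cu cb π) ≡ occAll x π + (sumBelow cu (length π) + sumBelow cb (length π)) * occ x [ n ]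
occAll-body x n cu cb [] = refl
occAll-body x n cu cb (P ∷ π) =
  trans (cong₂ _+_ (trans (occ-++ x P (replicate (cu m) n)) (cong (occ x P +_) (occ-replicate x (cu m) n)))
                   (trans (occAll-++ x (replicate (cb m) [ n ]) _)
                          (cong₂ _+_ (occAll-replicate x (cb m) n) (occAll-body x n cu cb π))))
    (lemma (occ x P) (cu m) (cb m) (occ x [ n ]) (occAll x π) (sumBelow cu m) (sumBelow cb m))
  where m = length π
        lemma : ∀ p a b o q su sb → p + a * o + (b * o + (q + (su + sb) * o)) ≡ p + q + (a + su + (b + sb)) * o
        lemma = solve-∀

occAll-shape : ∀ n π U B → All (_< length π) U → All (_≤ length π) B →
  ∀ x → occAll x (shape n π U B) ≡ occAll x π + (length U + length B) * occ x [ n ]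
occAll-shape n π U B hU hB x =
  trans (occAll-++ x (replicate (occ ℓ B) [ n ]) _)
    (trans (cong₂ _+_ (occAll-replicate x (occ ℓ B) n) (occAll-body x n (occs U) (occs B) π))
      (trans (lemma (occ ℓ B) (occ x [ n ]) (occAll x π) (sumBelow (occs U) ℓ) (sumBelow (occs B) ℓ))
        (cong₂ (λ u b → occAll x π + (u + b) * occ x [ n ]) (sumBelow-occ-length ℓ U hU) (sumBelow-occs-B ℓ B hB))))
  where ℓ = length π
        lemma : ∀ a o p su sb → a * o + (p + (su + sb) * o) ≡ p + (su + (a + sb)) * o
        lemma = solve-∀

IsBlock-extend : ∀ {n} P c → IsBlock P → All (_< n) P → c ≤ 1 → IsBlock (P ++ replicate c n)
IsBlock-extend P zero bP _ _ = subst IsBlock (sym (++-identityʳ P)) bP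
IsBlock-extend [] (suc zero) (P≢[] , _) _ _ = ⊥-elim (P≢[] refl)
IsBlock-extend (p ∷ P) (suc zero) (_ , lk) P<n _ = (λ ()) , Linked<-∷ʳ (p ∷ P) lk P<n
IsBlock-extend P (suc (suc c)) _ _ (s≤s ())

IsBlock-[n] : ∀ n → IsBlock [ n ]
IsBlock-[n] n = (λ ()) , [-]

blocks-body : ∀ n cb U π → BlocksBelow n π → Linked _>_ U → All IsBlock (body n (occs U) cb π)
blocks-body n cb U [] [] _ = []
blocks-body n cb U (P ∷ π) ((bP , P<n) ∷ g) lU =
  IsBlock-extend P (occ (length π) U) bP P<n (occ≤1 (length π) U lU)
  ∷ ++⁺ (replicate⁺ (cb (length π)) (IsBlock-[n] n)) (blocks-body n cb U π g lU)

blocks-shape : ∀ n π U B → BlocksBelow n π → Linked _>_ U → All IsBlock (shape n π U B)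
blocks-shape n π U B g lU = ++⁺ (replicate⁺ (occ (length π) B) (IsBlock-[n] n)) (blocks-body n (occs B) U π g lU)

filter-cong-on : ∀ {P Q : ℕ → Set} (P? : Decidable P) (Q? : Decidable Q) xs →
  All (λ x → P x ⇔ Q x) xs → filter P? xs ≡ filter Q? xs
filter-cong-on P? Q? [] [] = refl
filter-cong-on P? Q? (x ∷ xs) (P⇔Q ∷ h) with P? x | Q? x
... | yes _ | yes _ = cong (x ∷_) (filter-cong-on P? Q? xs h)
... | no _ | no _ = filter-cong-on P? Q? xs h
... | yes p | no ¬q = ⊥-elim (¬q (Equivalence.to P⇔Q p))
... | no ¬p | yes q = ⊥-elim (¬p (Equivalence.from P⇔Q q))

pairsFrom : ℕ → List ℕ → ℕ
pairsFrom a Q = length (filter (λ b → all? (b ≤?_) Q) (filter (_<? a) Q))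

pairsCount-∷ : ∀ a P Q → pairsCount (a ∷ P) Q ≡ pairsFrom a Q + pairsCount P Q
pairsCount-∷ a P Q =
  trans (cong length (filter-++ (λ b → all? (b ≤?_) Q) (filter (_<? a) Q) (concatMap (λ a → filter (_<? a) Q) P)))
        (length-++ (filter (λ b → all? (b ≤?_) Q) (filter (_<? a) Q)))

pairsCount-++ : ∀ Y Z Q → pairsCount (Y ++ Z) Q ≡ pairsCount Y Q + pairsCount Z Q
pairsCount-++ [] Z Q = refl
pairsCount-++ (y ∷ Y) Z Q =
  trans (pairsCount-∷ y (Y ++ Z) Q)
    (trans (cong (pairsFrom y Q +_) (pairsCount-++ Y Z Q))
      (trans (sym (+-assoc (pairsFrom y Q) _ _)) (cong (_+ pairsCount Z Q) (sym (pairsCount-∷ y Y Q)))))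

pairsCount-replicate : ∀ u n Q → pairsCount (replicate u n) Q ≡ u * pairsFrom n Q
pairsCount-replicate zero n Q = refl
pairsCount-replicate (suc u) n Q = trans (pairsCount-∷ n (replicate u n) Q) (cong (pairsFrom n Q +_) (pairsCount-replicate u n Q))

pairsCount-[n] : ∀ n Y → All (_≤ n) Y → pairsCount Y [ n ] ≡ 0
pairsCount-[n] n [] [] = refl
pairsCount-[n] n (y ∷ Y) (y≤n ∷ h) =
  trans (pairsCount-∷ y Y [ n ])
    (cong₂ _+_ (cong (λ l → length (filter (λ b → all? (b ≤?_) [ n ]) l)) (filter-reject (_<? y) (≤⇒≯ y≤n)))
               (pairsCount-[n] n Y h))

filter<-extend : ∀ a n Q v → a ≤ n → filter (_<? a) (Q ++ replicate v n) ≡ filter (_<? a) Q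
filter<-extend a n Q v a≤n =
  trans (filter-++ (_<? a) Q (replicate v n))
    (trans (cong (filter (_<? a) Q ++_) (filter-none (_<? a) (replicate⁺ v (≤⇒≯ a≤n)))) (++-identityʳ _))

pairsFrom-extend : ∀ a n Q v → a ≤ n → pairsFrom a (Q ++ replicate v n) ≡ pairsFrom a Q
pairsFrom-extend a n Q v a≤n =
  cong length (trans (cong (filter (λ b → all? (b ≤?_) (Q ++ replicate v n))) (filter<-extend a n Q v a≤n))
    (filter-cong-on (λ b → all? (b ≤?_) (Q ++ replicate v n)) (λ b → all? (b ≤?_) Q) (filter (_<? a) Q)
      (All.map (λ b<a → mk⇔ (++⁻ˡ Q) (λ b≤Q → ++⁺ b≤Q (replicate⁺ v (<⇒≤ (<-≤-trans b<a a≤n)))))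
               (all-filter (_<? a) Q))))

-- Below the new maximum n, the only entry of Q ++ n…n that is minimal in its block is min Q.
pairsFrom-top : ∀ n Q v → IsBlock Q → All (_< n) Q → pairsFrom n (Q ++ replicate v n) ≡ 1
pairsFrom-top n [] v (Q≢[] , _) _ = ⊥-elim (Q≢[] refl)
pairsFrom-top n (q ∷ Q) v (_ , lk) Q<n@(q<n ∷ _) =
  cong length (trans (cong (filter isMin?) (trans (filter<-extend n n (q ∷ Q) v ≤-refl) (filter-all (_<? n) Q<n)))
    (trans (filter-accept isMin? (++⁺ (≤-refl ∷ All.map <⇒≤ q<Q) (replicate⁺ v (<⇒≤ q<n))))
      (cong (q ∷_) (filter-none isMin? (All.map (λ q<b b≤all → <-irrefl refl (<-≤-trans q<b (All.head b≤all))) q<Q)))))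
  where
  isMin? = λ b → all? (b ≤?_) ((q ∷ Q) ++ replicate v n)
  q<Q = head-All <-trans lk

pairsCount-extend-right : ∀ n Y Q v → All (_< n) Y → pairsCount Y (Q ++ replicate v n) ≡ pairsCount Y Q
pairsCount-extend-right n [] Q v [] = refl
pairsCount-extend-right n (y ∷ Y) Q v (y<n ∷ h) =
  trans (pairsCount-∷ y Y _)
    (trans (cong₂ _+_ (pairsFrom-extend y n Q v (<⇒≤ y<n)) (pairsCount-extend-right n Y Q v h)) (sym (pairsCount-∷ y Y Q)))

pairsCount-extend : ∀ n Y Q u v → All (_< n) Y → IsBlock Q → All (_< n) Q →
  pairsCount (Y ++ replicate u n) (Q ++ replicate v n) ≡ pairsCount Y Q + u
pairsCount-extend n Y Q u v Y<n bQ Q<n =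
  trans (pairsCount-++ Y (replicate u n) _)
    (cong₂ _+_ (pairsCount-extend-right n Y Q v Y<n)
               (trans (pairsCount-replicate u n _) (trans (cong (u *_) (pairsFrom-top n Q v bQ Q<n)) (*-identityʳ u))))

sum-map-++ : ∀ (f : List ℕ → ℕ) ρ σ → sum (map f (ρ ++ σ)) ≡ sum (map f ρ) + sum (map f σ)
sum-map-++ f ρ σ = trans (cong sum (map-++ f ρ σ)) (sum-++ (map f ρ) (map f σ))

sum-pairsCount-singletons : ∀ n X c → All (_≤ n) X → sum (map (pairsCount X) (replicate c [ n ])) ≡ 0
sum-pairsCount-singletons n X zero _ = refl
sum-pairsCount-singletons n X (suc c) h = cong₂ _+_ (pairsCount-[n] n X h) (sum-pairsCount-singletons n X c h)

sum-pairsCount-body : ∀ n Y u cu cb π → All (_< n) Y → BlocksBelow n π →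
  sum (map (pairsCount (Y ++ replicate u n)) (body n cu cb π)) ≡ sum (map (pairsCount Y) π) + u * length π
sum-pairsCount-body n Y u cu cb [] _ [] = sym (*-zeroʳ u)
sum-pairsCount-body n Y u cu cb (Q ∷ π) Y<n ((bQ , Q<n) ∷ g) =
  trans (cong₂ _+_ (pairsCount-extend n Y Q u (cu m) Y<n bQ Q<n)
          (trans (sum-map-++ (pairsCount (Y ++ replicate u n)) (replicate (cb m) [ n ]) _)
            (cong₂ _+_ (sum-pairsCount-singletons n _ (cb m) (++⁺ (All.map <⇒≤ Y<n) (replicate⁺ u ≤-refl)))
                       (sum-pairsCount-body n Y u cu cb π Y<n g))))
    (lemma (pairsCount Y Q) u (sum (map (pairsCount Y) π)) m)
  where m = length π
        lemma : ∀ p u s m → p + u + (0 + (s + u * m)) ≡ p + s + u * suc m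
        lemma = solve-∀

sum-pairsCount-[n]-body : ∀ n cu cb π → BlocksBelow n π → sum (map (pairsCount [ n ]) (body n cu cb π)) ≡ length π
sum-pairsCount-[n]-body n cu cb π g =
  trans (sum-pairsCount-body n [] 1 cu cb π [] g) (trans (cong (_+ 1 * length π) (zeros π)) (*-identityˡ (length π)))
  where zeros : ∀ π → sum (map (pairsCount []) π) ≡ 0
        zeros [] = refl
        zeros (_ ∷ π) = zeros π

inv-singletons-++ : ∀ n c ρ → inv (replicate c [ n ] ++ ρ) ≡ c * sum (map (pairsCount [ n ]) ρ) + inv ρ
inv-singletons-++ n zero ρ = refl
inv-singletons-++ n (suc c) ρ =
  trans (cong₂ _+_ (trans (sum-map-++ (pairsCount [ n ]) (replicate c [ n ]) ρ)
                          (cong (_+ sum (map (pairsCount [ n ]) ρ)) (sum-pairsCount-singletons n [ n ] c (≤-refl ∷ []))))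
                   (inv-singletons-++ n c ρ))
    (sym (+-assoc (sum (map (pairsCount [ n ]) ρ)) _ _))

inv-body : ∀ n cu cb π → BlocksBelow n π →
  inv (body n cu cb π) ≡ inv π + sumBelow (λ j → j * cu j) (length π) + sumBelow (λ j → j * cb j) (length π)
inv-body n cu cb [] [] = refl
inv-body n cu cb (P ∷ π) ((bP , P<n) ∷ g) =
  trans (cong₂ _+_
     (trans (sum-map-++ (pairsCount (P ++ replicate (cu m) n)) (replicate (cb m) [ n ]) _)
        (cong₂ _+_ (sum-pairsCount-singletons n _ (cb m) (++⁺ (All.map <⇒≤ P<n) (replicate⁺ (cu m) ≤-refl)))
                   (sum-pairsCount-body n P (cu m) cu cb π P<n g)))
     (trans (inv-singletons-++ n (cb m) _)
        (cong₂ _+_ (cong (cb m *_) (sum-pairsCount-[n]-body n cu cb π g)) (inv-body n cu cb π g))))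
    (lemma (sum (map (pairsCount P) π)) (cu m) (cb m) m (inv π) (sumBelow (λ j → j * cu j) m) (sumBelow (λ j → j * cb j) m))
  where m = length π
        lemma : ∀ s a b m i su sb → 0 + (s + a * m) + (b * m + (i + su + sb)) ≡ s + i + (m * a + su) + (m * b + sb)
        lemma = solve-∀

inv-shape : ∀ n π U B → BlocksBelow n π → All (_< length π) U → All (_≤ length π) B →
  inv (shape n π U B) ≡ inv π + sum U + sum B
inv-shape n π U B g hU hB =
  trans (inv-singletons-++ n (occ ℓ B) _)
    (trans (cong₂ _+_ (cong (occ ℓ B *_) (sum-pairsCount-[n]-body n (occs U) (occs B) π g)) (inv-body n (occs U) (occs B) π g))
      (trans (lemma (occ ℓ B) ℓ (inv π) (sumBelow (λ j → j * occ j U) ℓ) (sumBelow (λ j → j * occ j B) ℓ))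
        (cong₂ (λ u b → inv π + u + b) (sumBelow-occ-sum ℓ U hU) (sumBelow-occ-sum (suc ℓ) B (All.map s≤s hB)))))
  where ℓ = length π
        lemma : ∀ c l i su sb → c * l + (i + su + sb) ≡ i + su + (l * c + sb)
        lemma = solve-∀

occAll-BlocksBelow : ∀ n π → BlocksBelow n π → occAll n π ≡ 0
occAll-BlocksBelow n [] [] = refl
occAll-BlocksBelow n (P ∷ π) ((_ , P<n) ∷ g) = cong₂ _+_ (occ-below P P<n ≤-refl) (occAll-BlocksBelow n π g)

occAll-shape-top : ∀ n π U B → BlocksBelow n π → All (_< length π) U → All (_≤ length π) B →
  occAll n (shape n π U B) ≡ length U + length B
occAll-shape-top n π U B g hU hB = begin
  occAll n (shape n π U B)                         ≡⟨ occAll-shape n π U B hU hB n ⟩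
  occAll n π + (length U + length B) * occ n [ n ] ≡⟨ cong₂ (λ p o → p + (length U + length B) * o)
                                                            (occAll-BlocksBelow n π g) (occ-self n) ⟩
  (length U + length B) * 1                        ≡⟨ *-identityʳ _ ⟩
  length U + length B                              ∎
  where open ≡-Reasoning

occAll-shape-other : ∀ n π U B → All (_< length π) U → All (_≤ length π) B →
  ∀ {x} → x ≢ n → occAll x (shape n π U B) ≡ occAll x π
occAll-shape-other n π U B hU hB {x} x≢n = begin
  occAll x (shape n π U B)                         ≡⟨ occAll-shape n π U B hU hB x ⟩
  occAll x π + (length U + length B) * occ x [ n ] ≡⟨ cong (λ o → occAll x π + (length U + length B) * o) (occ-other x≢n) ⟩
  occAll x π + (length U + length B) * 0           ≡⟨ cong (occAll x π +_) (*-zeroʳ (length U + length B)) ⟩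
  occAll x π + 0                                   ≡⟨ +-identityʳ _ ⟩
  occAll x π                                       ∎
  where open ≡-Reasoning

-- Decoding the closed form

replicate-++-∷-injective : ∀ {n : ℕ} {X X′ : List ℕ} c c′ r r′ → X ≢ [ n ] → X′ ≢ [ n ] →
  replicate c [ n ] ++ X ∷ r ≡ replicate c′ [ n ] ++ X′ ∷ r′ → c ≡ c′ × X ≡ X′ × r ≡ r′
replicate-++-∷-injective zero zero r r′ _ _ eq = refl , ∷-injective eq
replicate-++-∷-injective zero (suc c′) r r′ X≢ _ eq = ⊥-elim (X≢ (proj₁ (∷-injective eq)))
replicate-++-∷-injective (suc c) zero r r′ _ X′≢ eq = ⊥-elim (X′≢ (sym (proj₁ (∷-injective eq))))
replicate-++-∷-injective (suc c) (suc c′) r r′ X≢ X′≢ eq =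
  map₁ (cong suc) (replicate-++-∷-injective c c′ r r′ X≢ X′≢ (proj₂ (∷-injective eq)))

++-replicate-injective : ∀ {n} P P′ c c′ → All (_< n) P → All (_< n) P′ →
  P ++ replicate c n ≡ P′ ++ replicate c′ n → P ≡ P′ × c ≡ c′
++-replicate-injective [] [] c c′ _ _ eq = refl , trans (sym (length-replicate c)) (trans (cong length eq) (length-replicate c′))
++-replicate-injective [] (p′ ∷ P′) zero c′ _ _ ()
++-replicate-injective [] (p′ ∷ P′) (suc c) c′ _ (p′<n ∷ _) eq = ⊥-elim (<-irrefl (sym (proj₁ (∷-injective eq))) p′<n)
++-replicate-injective (p ∷ P) [] c zero _ _ ()
++-replicate-injective (p ∷ P) [] c (suc c′) (p<n ∷ _) _ eq = ⊥-elim (<-irrefl (proj₁ (∷-injective eq)) p<n)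
++-replicate-injective (p ∷ P) (p′ ∷ P′) c c′ (_ ∷ P<n) (_ ∷ P′<n) eq with ∷-injective eq
... | p≡p′ , eq′ = map₁ (cong₂ _∷_ p≡p′) (++-replicate-injective P P′ c c′ P<n P′<n eq′)

singletons-++-body-injective : ∀ n {cu cb cu′ cb′} π π′ c c′ → BlocksBelow n π → BlocksBelow n π′ → length π ≡ length π′ →
  replicate c [ n ] ++ body n cu cb π ≡ replicate c′ [ n ] ++ body n cu′ cb′ π′ →
  c ≡ c′ × body n cu cb π ≡ body n cu′ cb′ π′
singletons-++-body-injective n [] [] c c′ _ _ _ eq =
  trans (sym (length-replicate c)) (trans (cong length (trans (sym (++-identityʳ _)) (trans eq (++-identityʳ _)))) (length-replicate c′)) , refl
singletons-++-body-injective n {cu} {cb} {cu′} {cb′} (P ∷ π) (P′ ∷ π′) c c′ ((bP , P<n) ∷ _) ((bP′ , P′<n) ∷ _) _ eq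
  with replicate-++-∷-injective c c′ _ _ (extended-block≢[n] P (cu (length π)) bP P<n) (extended-block≢[n] P′ (cu′ (length π′)) bP′ P′<n) eq
... | c≡c′ , X≡X′ , r≡r′ = c≡c′ , cong₂ _∷_ X≡X′ r≡r′

body-injective : ∀ n {cu cb cu′ cb′} π π′ → BlocksBelow n π → BlocksBelow n π′ → length π ≡ length π′ →
  body n cu cb π ≡ body n cu′ cb′ π′ →
  π ≡ π′ × (∀ j → j < length π → cu j ≡ cu′ j) × (∀ j → j < length π → cb j ≡ cb′ j)
body-injective n [] [] _ _ _ _ = refl , (λ _ ()) , (λ _ ())
body-injective n {cu} {cb} {cu′} {cb′} (P ∷ π) (P′ ∷ π′) ((_ , P<n) ∷ g) ((_ , P′<n) ∷ g′) |π|+1≡ eq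
  with eq-block , eq-rest ← ∷-injective eq
  with P≡P′ , cu≡ ← ++-replicate-injective P P′ _ _ P<n P′<n eq-block
  with cb≡ , eq-body ← singletons-++-body-injective n π π′ _ _ g g′ (suc-injective |π|+1≡) eq-rest
  with π≡π′ , hu , hb ← body-injective n π π′ g g′ (suc-injective |π|+1≡) eq-body
  = cong₂ _∷_ P≡P′ π≡π′ , extend hu (trans cu≡ (cong cu′ m′≡m)) , extend hb (trans cb≡ (cong cb′ m′≡m))
  where
  m′≡m = sym (suc-injective |π|+1≡)
  extend : ∀ {f g : ℕ → ℕ} → (∀ j → j < length π → f j ≡ g j) → f (length π) ≡ g (length π) →
    ∀ j → j < suc (length π) → f j ≡ g j
  extend h top j j<1+m with m<1+n⇒m<n∨m≡n j<1+m
  ... | inj₁ j<m = h j j<m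
  ... | inj₂ refl = top

shape-injective : ∀ n π π′ U U′ B B′ → BlocksBelow n π → BlocksBelow n π′ → length π ≡ length π′ →
  IsSubsetBelow (length π) U → IsSubsetBelow (length π′) U′ →
  Linked _≥_ B → All (_≤ length π) B → Linked _≥_ B′ → All (_≤ length π′) B′ →
  shape n π U B ≡ shape n π′ U′ B′ → π ≡ π′ × U ≡ U′ × B ≡ B′
shape-injective n π π′ U U′ B B′ g g′ ℓ≡ (lU , U<ℓ) (lU′ , U′<ℓ) lB B≤ℓ lB′ B′≤ℓ eq
  with singletons-++-body-injective n π π′ _ _ g g′ ℓ≡ eq
... | top≡ , eq-body with body-injective n π π′ g g′ ℓ≡ eq-body
... | refl , hu , hb =
  refl , ≥-sorted-occ-unique U U′ (Linked.map <⇒≤ lU) (Linked.map <⇒≤ lU′) occU , ≥-sorted-occ-unique B B′ lB lB′ occB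
  where
  ℓ = length π
  occU : ∀ j → occ j U ≡ occ j U′
  occU j with <-cmp j ℓ
  ... | tri< j<ℓ _ _ = hu j j<ℓ
  ... | tri≈ _ refl _ = trans (occ-below U U<ℓ ≤-refl) (sym (occ-below U′ U′<ℓ ≤-refl))
  ... | tri> _ _ ℓ<j = trans (occ-below U U<ℓ (<⇒≤ ℓ<j)) (sym (occ-below U′ U′<ℓ (<⇒≤ ℓ<j)))
  occB : ∀ j → occ j B ≡ occ j B′
  occB j with <-cmp j ℓ
  ... | tri< j<ℓ _ _ = hb j j<ℓ
  ... | tri≈ _ refl _ = top≡
  ... | tri> _ _ ℓ<j = trans (occ-above B B≤ℓ ℓ<j) (sym (occ-above B′ B′≤ℓ ℓ<j))

splitTop : ∀ n X → Linked _<_ X → All (_≤ n) X →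
  Σ[ Y ∈ List ℕ ] Σ[ c ∈ ℕ ] (Y ++ replicate c n ≡ X × c ≤ 1 × Linked _<_ Y × All (_< n) Y)
splitTop n [] _ _ = [] , 0 , refl , z≤n , [] , []
splitTop n (x ∷ []) _ (x≤n ∷ []) with x ≟ n
... | yes refl = [] , 1 , refl , ≤-refl , [] , []
... | no x≢n = [ x ] , 0 , refl , z≤n , [-] , (≤∧≢⇒< x≤n x≢n ∷ [])
splitTop n (x ∷ y ∷ xs) lk (_ ∷ h) with splitTop n (y ∷ xs) (Linked.tail lk) h
... | Y , c , eq , c≤1 , lY , Y<n = x ∷ Y , c , cong (x ∷_) eq , c≤1 , Linked-∷ Y x<Y lY , (<-≤-trans (Linked.head lk) (All.head h) ∷ Y<n)
  where x<Y = ++⁻ˡ Y (subst (All (x <_)) (sym eq) (head-All <-trans lk))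

body-cong : ∀ n {cu cu′ cb cb′} π → (∀ j → j < length π → cu j ≡ cu′ j) → (∀ j → j < length π → cb j ≡ cb′ j) →
  body n cu cb π ≡ body n cu′ cb′ π
body-cong n [] hu hb = refl
body-cong n (P ∷ π) hu hb
  rewrite hu (length π) ≤-refl | hb (length π) ≤-refl
        | body-cong n π (λ j j< → hu j (m<n⇒m<1+n j<)) (λ j j< → hb j (m<n⇒m<1+n j<)) = refl

occs-∷-below : ∀ l {i j} → j < i → occs (i ∷ l) j ≡ occs l j
occs-∷-below l j<i = occ-∷-≢ l (<⇒≢ j<i)

Decomposes : ℕ → List (List ℕ) → List (List ℕ) → List ℕ → List ℕ → Set
Decomposes n ρ π U B = shape n π U B ≡ ρ × BlocksBelow n π × IsSubsetBelow (length π) U × Linked _≥_ B × All (_≤ length π) B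

decompose : ∀ n ρ → All IsBlock ρ → All (All (_≤ n)) ρ → Σ[ π ∈ List (List ℕ) ] Σ[ U ∈ List ℕ ] Σ[ B ∈ List ℕ ] Decomposes n ρ π U B
decompose n [] _ _ = [] , [] , [] , refl , [] , ([] , []) , [] , []
decompose n (X ∷ _) (bX ∷ bs) (X≤n ∷ hs) with decompose n _ bs hs
... | π , U , B , refl , g , (lU , U<ℓ) , lB , B≤ℓ with ≡-dec _≟_ X [ n ]
...   | yes refl = π , U , ℓ ∷ B , new , g , (lU , U<ℓ) , Linked-∷ B B≤ℓ lB , ≤-refl ∷ B≤ℓ
  where
  ℓ = length π
  new : shape n π U (ℓ ∷ B) ≡ [ n ] ∷ shape n π U B
  new = cong₂ (λ c r → replicate c [ n ] ++ r) (occ-∷-≡ ℓ B) (body-cong n π (λ _ _ → refl) (λ j → occs-∷-below B))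
...   | no X≢[n] with splitTop n X (proj₂ bX) X≤n
...     | Y , zero , refl , _ , lY , Y<n =
          Y ∷ π , U , B , old , ((Y≢[] , lY) , Y<n) ∷ g , (lU , All.map m<n⇒m<1+n U<ℓ) , lB , All.map m≤n⇒m≤1+n B≤ℓ
  where
  ℓ = length π
  Y≢[] : Y ≢ []
  Y≢[] refl = proj₁ bX refl
  old : shape n (Y ∷ π) U B ≡ (Y ++ []) ∷ shape n π U B
  old = cong₂ (λ c u → replicate c [ n ] ++ (Y ++ replicate u n) ∷ shape n π U B)
              (occ-above B B≤ℓ ≤-refl) (occ-below U U<ℓ ≤-refl)
...     | Y , suc zero , refl , _ , lY , Y<n =
          Y ∷ π , ℓ ∷ U , B , old , ((Y≢[] , lY) , Y<n) ∷ g , (Linked-∷ U U<ℓ lU , ≤-refl ∷ All.map m<n⇒m<1+n U<ℓ) , lB , All.map m≤n⇒m≤1+n B≤ℓ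
  where
  ℓ = length π
  Y≢[] : Y ≢ []
  Y≢[] refl = X≢[n] refl
  old : shape n (Y ∷ π) (ℓ ∷ U) B ≡ (Y ++ [ n ]) ∷ shape n π U B
  old = cong₂ (λ c ρ → replicate c [ n ] ++ ρ) (occ-above B B≤ℓ ≤-refl)
          (cong₂ _∷_ (cong (λ u → Y ++ replicate u n) (trans (occ-∷-≡ ℓ U) (cong suc (occ-below U U<ℓ ≤-refl))))
                     (cong (replicate (occ ℓ B) [ n ] ++_) (body-cong n π (λ j → occs-∷-below U) (λ _ _ → refl))))
...     | _ , suc (suc _) , _ , s≤s () , _

length-∷ʳ : ∀ (α : List ℕ) a → length (α ∷ʳ a) ≡ suc (length α)
length-∷ʳ α a = trans (length-++ α) (+-comm (length α) 1)

mult-above : ∀ α x → length α < x → mult α x ≡ 0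
mult-above α zero ()
mult-above [] (suc x) _ = refl
mult-above (_ ∷ α) (suc zero) (s≤s ())
mult-above (_ ∷ α) (suc (suc x)) (s≤s |α|<1+x) = mult-above α (suc x) |α|<1+x

mult-∷ʳ-last : ∀ α a → mult (α ∷ʳ a) (suc (length α)) ≡ a
mult-∷ʳ-last [] a = refl
mult-∷ʳ-last (_ ∷ α) a = mult-∷ʳ-last α a

mult-∷ʳ-other : ∀ α a {x} → x ≢ suc (length α) → mult (α ∷ʳ a) x ≡ mult α x
mult-∷ʳ-other α a {zero} _ = refl
mult-∷ʳ-other [] a {suc zero} x≢1 = ⊥-elim (x≢1 refl)
mult-∷ʳ-other [] a {suc (suc x)} _ = refl
mult-∷ʳ-other (_ ∷ α) a {suc zero} _ = refl
mult-∷ʳ-other (_ ∷ α) a {suc (suc x)} x≢ = mult-∷ʳ-other α a (λ eq → x≢ (cong suc eq))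

entries<-of-OP : ∀ α k ρ → OP α k ρ → All (All (_< suc (length α))) ρ
entries<-of-OP α k ρ (_ , _ , occ≡) = All<-of-occAll _ ρ (λ y |α|<y → trans (occ≡ y) (mult-above α y |α|<y))

BlocksBelow-of-OP : ∀ α ℓ π → OP α ℓ π → BlocksBelow (suc (length α)) π
BlocksBelow-of-OP α ℓ π op@(_ , blocks , _) = All.zip (blocks , entries<-of-OP α ℓ π op)

Domain : List ℕ → ℕ → ℕ → ℕ → List (List ℕ) → List ℕ → List ℕ → Set
Domain α⁻ a k ℓ π U B = OP α⁻ ℓ π × (IsSubsetBelow ℓ U × (length U + k ≡ a + ℓ)) × IsMultisetOf ℓ (k ∸ ℓ) B

+∸+ : ∀ u {k ℓ} → ℓ ≤ k → u + (k ∸ ℓ) + ℓ ≡ u + k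
+∸+ u {k} {ℓ} ℓ≤k = trans (+-assoc u (k ∸ ℓ) ℓ) (cong (u +_) (m∸n+n≡m ℓ≤k))

|U|+|B|≡a : ∀ {u a k ℓ} → ℓ ≤ k → u + k ≡ a + ℓ → u + (k ∸ ℓ) ≡ a
|U|+|B|≡a {u} {a} {k} {ℓ} ℓ≤k u+k≡a+ℓ = +-cancelʳ-≡ ℓ (u + (k ∸ ℓ)) a (trans (+∸+ u ℓ≤k) u+k≡a+ℓ)

|U|+k≡a+ℓ : ∀ {u a k ℓ} → ℓ ≤ k → u + (k ∸ ℓ) ≡ a → u + k ≡ a + ℓ
|U|+k≡a+ℓ {u} {a} {k} {ℓ} ℓ≤k u+[k∸ℓ]≡a = trans (sym (+∸+ u ℓ≤k)) (cong (_+ ℓ) u+[k∸ℓ]≡a)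

phiInv-OP : ∀ α⁻ a k ℓ π U B → ℓ ≤ k → Domain α⁻ a k ℓ π U B → OP (α⁻ ∷ʳ a) k (phiInv (suc (length α⁻)) ℓ π U B)
phiInv-OP α⁻ a k ℓ π U B ℓ≤k (op@(refl , _ , occ≡) , ((lU , U<ℓ) , |U|+k) , (_ , B≤ℓ , |B|))
  rewrite phiInv≡shape (suc (length α⁻)) π U B =
    trans (length-shape n π U B B≤ℓ) (trans (cong (length π +_) |B|) (m+[n∸m]≡n ℓ≤k))
  , blocks-shape n π U B g lU
  , occ≡mult
  where
  n = suc (length α⁻)
  g = BlocksBelow-of-OP α⁻ ℓ π op
  occ≡mult : ∀ x → occAll x (shape n π U B) ≡ mult (α⁻ ∷ʳ a) x
  occ≡mult x with x ≟ n
  ... | yes refl = trans (occAll-shape-top n π U B g U<ℓ B≤ℓ) (trans (cong (length U +_) |B|) (trans (|U|+|B|≡a ℓ≤k |U|+k) (sym (mult-∷ʳ-last α⁻ a))))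
  ... | no x≢n = trans (occAll-shape-other n π U B U<ℓ B≤ℓ x≢n) (trans (occ≡ x) (sym (mult-∷ʳ-other α⁻ a x≢n)))

phiInv-singletons : ∀ α⁻ a k ℓ π U B → Domain α⁻ a k ℓ π U B →
  singletons (suc (length α⁻)) (phiInv (suc (length α⁻)) ℓ π U B) ≡ k ∸ ℓ
phiInv-singletons α⁻ a k ℓ π U B (op@(refl , _) , _ , (_ , B≤ℓ , |B|))
  rewrite phiInv≡shape (suc (length α⁻)) π U B =
    trans (singletons-shape _ π U B (BlocksBelow-of-OP α⁻ ℓ π op) B≤ℓ) |B|

phiInv-inv : ∀ α⁻ a k ℓ π U B → Domain α⁻ a k ℓ π U B →
  inv (phiInv (suc (length α⁻)) ℓ π U B) ≡ inv π + sum U + sum B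
phiInv-inv α⁻ a k ℓ π U B (op@(refl , _) , ((_ , U<ℓ) , _) , (_ , B≤ℓ , _))
  rewrite phiInv≡shape (suc (length α⁻)) π U B = inv-shape _ π U B (BlocksBelow-of-OP α⁻ ℓ π op) U<ℓ B≤ℓ

phiInv-injective : ∀ α⁻ a k ℓ π π′ U U′ B B′ → Domain α⁻ a k ℓ π U B → Domain α⁻ a k ℓ π′ U′ B′ →
  phiInv (suc (length α⁻)) ℓ π U B ≡ phiInv (suc (length α⁻)) ℓ π′ U′ B′ → π ≡ π′ × U ≡ U′ × B ≡ B′
phiInv-injective α⁻ a k ℓ π π′ U U′ B B′ (op@(refl , _) , (sU , _) , (lB , B≤ℓ , _)) (op′@(|π′| , _) , (sU′ , _) , (lB′ , B′≤ℓ , _)) eq =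
  shape-injective n π π′ U U′ B B′ (BlocksBelow-of-OP α⁻ ℓ π op) (BlocksBelow-of-OP α⁻ ℓ π′ op′) (sym |π′|)
    sU (subst (λ m → IsSubsetBelow m U′) (sym |π′|) sU′) lB B≤ℓ lB′ (subst (λ m → All (_≤ m) B′) (sym |π′|) B′≤ℓ)
    (trans (sym (phiInv≡shape n π U B)) (trans eq (subst (λ m → phiInv n m π′ U′ B′ ≡ shape n π′ U′ B′) |π′| (phiInv≡shape n π′ U′ B′))))
  where n = suc (length α⁻)

decomposition-sizes : ∀ {n k ℓ} → ℓ ≤ k → ∀ π U B → BlocksBelow n π → All (_≤ length π) B →
  length (shape n π U B) ≡ k → singletons n (shape n π U B) ≡ k ∸ ℓ → length π ≡ ℓ × length B ≡ k ∸ ℓ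
decomposition-sizes {n} {k} {ℓ} ℓ≤k π U B g B≤ℓ |shape| s = |π| , |B|
  where
  |B| : length B ≡ k ∸ ℓ
  |B| = trans (sym (singletons-shape n π U B g B≤ℓ)) s
  |π| : length π ≡ ℓ
  |π| = +-cancelʳ-≡ (k ∸ ℓ) (length π) ℓ
          (trans (cong (length π +_) (sym |B|)) (trans (sym (length-shape n π U B B≤ℓ)) (trans |shape| (sym (m+[n∸m]≡n ℓ≤k)))))

phiInv-surjective : ∀ α⁻ a k ℓ ρ → ℓ ≤ k → OP (α⁻ ∷ʳ a) k ρ → singletons (suc (length α⁻)) ρ ≡ k ∸ ℓ →
  Σ[ π ∈ List (List ℕ) ] Σ[ U ∈ List ℕ ] Σ[ B ∈ List ℕ ] (Domain α⁻ a k ℓ π U B × phiInv (suc (length α⁻)) ℓ π U B ≡ ρ)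
phiInv-surjective α⁻ a k ℓ ρ ℓ≤k op@(|ρ| , blocks , occ≡) s
  with decompose (suc (length α⁻)) ρ blocks
         (All.map (All.map ≤-pred) (subst (λ m → All (All (_< suc m)) ρ) (length-∷ʳ α⁻ a) (entries<-of-OP (α⁻ ∷ʳ a) k ρ op)))
... | π , U , B , refl , g , sU@(_ , U<ℓ) , lB , B≤ℓ
  with refl , |B| ← decomposition-sizes ℓ≤k π U B g B≤ℓ |ρ| s
  = π , U , B , ((refl , All.map proj₁ g , occπ) , (sU , |U|+k) , (lB , B≤ℓ , |B|)) , phiInv≡shape n π U B
  where
  n = suc (length α⁻)
  occπ : ∀ x → occAll x π ≡ mult α⁻ x
  occπ x with x ≟ n
  ... | yes refl = trans (occAll-BlocksBelow n π g) (sym (mult-above α⁻ n ≤-refl))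
  ... | no x≢n = trans (sym (occAll-shape-other n π U B U<ℓ B≤ℓ x≢n)) (trans (occ≡ x) (mult-∷ʳ-other α⁻ a x≢n))
  |U|+k : length U + k ≡ a + length π
  |U|+k = |U|+k≡a+ℓ ℓ≤k (begin
    length U + (k ∸ length π) ≡⟨ cong (length U +_) |B| ⟨
    length U + length B       ≡⟨ occAll-shape-top n π U B g U<ℓ B≤ℓ ⟨
    occAll n (shape n π U B)  ≡⟨ occ≡ n ⟩
    mult (α⁻ ∷ʳ a) n          ≡⟨ mult-∷ʳ-last α⁻ a ⟩
    a                         ∎)
    where open ≡-Reasoning

lemma3p2 : (α⁻ : List ℕ) (a k ℓ : ℕ) → IsComposition (α⁻ ∷ʳ a) → 1 ≤ ℓ → ℓ ≤ k →
  let n = suc (length α⁻)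
      Dom = λ π U B → OP α⁻ ℓ π × (IsSubsetBelow ℓ U × (length U + k ≡ a + ℓ)) × IsMultisetOf ℓ (k ∸ ℓ) B
  in ((π : List (List ℕ)) (U B : List ℕ) → Dom π U B → OP (α⁻ ∷ʳ a) k (phiInv n ℓ π U B))
   × ((π π′ : List (List ℕ)) (U U′ B B′ : List ℕ) → Dom π U B → Dom π′ U′ B′ →
        phiInv n ℓ π U B ≡ phiInv n ℓ π′ U′ B′ → (π ≡ π′) × (U ≡ U′) × (B ≡ B′))
   × ((ρ : List (List ℕ)) →
        ((Σ[ π ∈ List (List ℕ) ] Σ[ U ∈ List ℕ ] Σ[ B ∈ List ℕ ] (Dom π U B × (phiInv n ℓ π U B ≡ ρ)))
          → (OP (α⁻ ∷ʳ a) k ρ × (singletons n ρ ≡ k ∸ ℓ)))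
      × ((OP (α⁻ ∷ʳ a) k ρ × (singletons n ρ ≡ k ∸ ℓ))
          → Σ[ π ∈ List (List ℕ) ] Σ[ U ∈ List ℕ ] Σ[ B ∈ List ℕ ] (Dom π U B × (phiInv n ℓ π U B ≡ ρ))))
   × ((π : List (List ℕ)) (U B : List ℕ) → Dom π U B →
        inv (phiInv n ℓ π U B) ≡ inv π + sum U + sum B)
lemma3p2 α⁻ a k ℓ _ _ ℓ≤k =
    (λ π U B → phiInv-OP α⁻ a k ℓ π U B ℓ≤k)
  , phiInv-injective α⁻ a k ℓ
  , (λ ρ → (λ { (π , U , B , d , refl) → phiInv-OP α⁻ a k ℓ π U B ℓ≤k d , phiInv-singletons α⁻ a k ℓ π U B d })
         , (λ { (op , s) → phiInv-surjective α⁻ a k ℓ ρ ℓ≤k op s }))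
  , phiInv-inv α⁻ a k ℓ
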